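{- Let $(V,E)$ be a finite simple undirected graph and let $\Delta$ be its set of triangles, each viewed as a set of three edges. Consider the optimization problem $$\min \sum_{e\in E}\Big(\sum_{T\in\Delta,\ e\in T} x_{T,e}\Big)^2\quad\text{s.t.}\quad \sum_{e\in T}x_{T,e}=1\ \ \forall T\in\Delta,\qquad x_{T,e}\in\{0,1\}\ \ \forall T\in\Delta,\ e\in T.$$ Let the greedy procedure be: initialize $l(e)=0$ for all $e\in E$; process the triangles $T\in\Delta$ one by one (in any order); for the current $T$ choose an edge $e\in T$ minimizing the current $l(e)$ (ties arbitrary), set $x_{T,e}=1$ (and $x_{T,e'}=0$ for the other two edges $e'$ of $T$), and increase $l(e)$ by $1$. Then the objective value of the greedy solution is at most $3+2\sqrt{2}$ times the optimal objective value of the problem. -}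

module Defs where

open import Data.Nat using (ℕ; zero; suc; _+_; _*_; _∸_; _≤_)
open import Data.Fin using (Fin; zero; suc) renaming (_<_ to _<ᶠ_)
open import Data.Fin.Properties using () renaming (_≟_ to _≟ᶠ_; _<?_ to _<?ᶠ_)
open import Data.Bool using (Bool; true; false; _∧_; T)
open import Data.Product using (_×_; _,_; proj₁)
open import Data.Product.Properties using (≡-dec)
open import Data.List using (List; []; _∷_; _++_; [_]; map; filter; length; concatMap; allFin)
open import Data.Nat.ListAction using (sum)
open import Data.List.Relation.Binary.Permutation.Propositional using (_↭_)
open import Relation.Binary.PropositionalEquality using (_≡_)
open import Relation.Nullary using (¬_; Dec; yes; no; does)
open import Relation.Binary.Definitions using (DecidableEquality)

record Graph (n : ℕ) : Set where
  field
    adj    : Fin n → Fin n → Bool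
    sym    : ∀ i j → adj i j ≡ adj j i
    irrefl : ∀ i → adj i i ≡ false
open Graph public

-- An (undirected) edge {i,j} is represented canonically as the pair (i , j) with i < j.
Edge : ℕ → Set
Edge n = Fin n × Fin n

-- A triangle {i,j,k} is represented canonically as (i , j , k) with i < j < k.
Tri : ℕ → Set
Tri n = Fin n × Fin n × Fin n

_≟E_ : ∀ {n} → DecidableEquality (Edge n)
_≟E_ = ≡-dec _≟ᶠ_ _≟ᶠ_

_≟T_ : ∀ {n} → DecidableEquality (Tri n)
_≟T_ = ≡-dec _≟ᶠ_ (≡-dec _≟ᶠ_ _≟ᶠ_)

lt : ∀ {n} → Fin n → Fin n → Bool
lt i j = does (i <?ᶠ j)

edges : ∀ {n} → Graph n → List (Edge n)
edges {n} G =
  concatMap (λ i → concatMap (λ j →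
    if' (lt i j ∧ adj G i j) ((i , j) ∷ []) []) (allFin n)) (allFin n)
  where
  if' : ∀ {A : Set} → Bool → A → A → A
  if' true  a _ = a
  if' false _ b = b

triangles : ∀ {n} → Graph n → List (Tri n)
triangles {n} G =
  concatMap (λ i → concatMap (λ j → concatMap (λ k →
    if' (lt i j ∧ lt j k ∧ adj G i j ∧ adj G i k ∧ adj G j k)
        ((i , j , k) ∷ []) []) (allFin n)) (allFin n)) (allFin n)
  where
  if' : ∀ {A : Set} → Bool → A → A → A
  if' true  a _ = a
  if' false _ b = b

triEdge : ∀ {n} → Tri n → Fin 3 → Edge n
triEdge (i , j , k) zero             = (i , j)
triEdge (i , j , k) (suc zero)       = (i , k)
triEdge (i , j , k) (suc (suc zero)) = (j , k)

-- A feasible solution x (x_{T,e} ∈ {0,1}, Σ_{e∈T} x_{T,e} = 1) is exactly a choice,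
-- for each triangle T, of one of its three edges: x_{T,e} = 1 iff e = triEdge T (σ T).
Assignment : ℕ → Set
Assignment n = Tri n → Fin 3

loadA : ∀ {n} → Graph n → Assignment n → Edge n → ℕ
loadA G σ e = length (filter (λ t → triEdge t (σ t) ≟E e) (triangles G))

objective : ∀ {n} → Graph n → Assignment n → ℕ
objective G σ = sum (map (λ e → loadA G σ e * loadA G σ e) (edges G))

loadL : ∀ {n} → List (Tri n × Fin 3) → Edge n → ℕ
loadL ps e = length (filter (λ p → triEdge (proj₁ p) (Data.Product.proj₂ p) ≟E e) ps)

data GreedyRun {n : ℕ} : List (Tri n × Fin 3) → Set where
  done : GreedyRun []
  step : ∀ {ps} → GreedyRun ps → (t : Tri n) (c : Fin 3) →
         (∀ c' → loadL ps (triEdge t c) ≤ loadL ps (triEdge t c')) →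
         GreedyRun (ps ++ [ (t , c) ])

record Greedy {n : ℕ} (G : Graph n) : Set where
  field
    decisions : List (Tri n × Fin 3)
    isRun     : GreedyRun decisions
    covers    : map proj₁ decisions ↭ triangles G
open Greedy public

greedyObjective : ∀ {n} {G : Graph n} → Greedy G → ℕ
greedyObjective {G = G} g =
  sum (map (λ e → loadL (decisions g) e * loadL (decisions g) e) (edges G))

-- a ≤ (3 + 2√2) · b for natural numbers a, b, stated exactly:
-- a - 3b ≤ 2√2 b  ⟺  a ≤ 3b  or  (a - 3b)^2 ≤ 8 b^2.
data LeqThreePlusTwoSqrt2Times (a b : ℕ) : Set where
  small : a ≤ 3 * b → LeqThreePlusTwoSqrt2Times a b
  large : (a ∸ 3 * b) * (a ∸ 3 * b) ≤ 8 * (b * b) → LeqThreePlusTwoSqrt2Times a b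

{-# OPTIONS --safe #-}

-- Let ℓ be the greedy loads and o the loads of an arbitrary feasible σ, and put
-- G = Σ ℓ², O = Σ o², P = Σ o ℓ over the edges.  When greedy gives a triangle T an
-- edge e of least current load, the potential Σ ℓ² grows by 2ℓ(e) + 1, which is at
-- most 2ℓ(σ T) + 1 for the current and hence for the final loads.  Summing over the
-- triangles and regrouping by edges gives G ≤ Σ o (2ℓ + 1) ≤ O + 2P, and
-- Cauchy–Schwarz gives P² ≤ O G.  Writing G = 3O + d, these give
-- (2O + d)² ≤ 4P² ≤ 4O(3O + d), i.e. d² ≤ 8O², which is G ≤ (3 + 2√2) O.

module Submission where

open import Defs hiding (sym)
open import Data.Bool using (true; false; if_then_else_; _∧_)
open import Data.Fin using (Fin; zero; suc)
open import Data.Fin.Properties using () renaming (_<?_ to _<?ᶠ_; <-trans to <ᶠ-trans)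
open import Data.List using (List; []; _∷_; _++_; [_]; map; filter; length; concatMap; allFin; cartesianProduct)
open import Data.List.Membership.Propositional using (_∈_; lose)
open import Data.List.Membership.Propositional.Properties using (∈-allFin; ∈-concatMap⁺)
open import Data.List.Properties using (map-cong; map-++; map-∘; filter-++; length-++; filter-some; filter-none; concatMap-map; concatMap-pure)
open import Data.List.Relation.Binary.Permutation.Propositional.Properties using (map⁺)
open import Data.List.Relation.Unary.All as All using (All; []; _∷_)
open import Data.List.Relation.Unary.All.Properties using (concat⁺) renaming (map⁺ to All-map⁺)
open import Data.List.Relation.Unary.Any as Any using (here)
open import Data.List.Relation.Unary.AllPairs using ([]; _∷_)
open import Data.List.Relation.Unary.Unique.Propositional using (Unique)
open import Data.List.Relation.Unary.Unique.Propositional.Properties using (allFin⁺; cartesianProduct⁺)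
open import Data.Nat using (ℕ; zero; suc; _+_; _*_; _∸_; _≤_; _≤?_; z≤n; s≤s)
open import Data.Nat.ListAction using (sum)
open import Data.Nat.ListAction.Properties using (sum-++; sum-↭)
open import Data.Nat.Properties
open import Algebra.Properties.CommutativeSemigroup +-commutativeSemigroup using (interchange)
open import Data.Nat.Tactic.RingSolver using (solve-∀)
open import Data.Product using (Σ-syntax; _×_; _,_; proj₁)
open import Function using (id; _∘_)
open import Relation.Binary.Definitions using (DecidableEquality)
open import Relation.Binary.PropositionalEquality using (_≡_; refl; sym; trans; cong; cong₂; subst; subst₂; module ≡-Reasoning)
open import Relation.Nullary using (Dec; yes; no; does; contradiction)
open import Relation.Nullary.Decidable using (dec-true)

[m+n]²≡m²+n[2m+n] : ∀ m n → (m + n) * (m + n) ≡ m * m + n * (2 * m + n)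
[m+n]²≡m²+n[2m+n] = solve-∀

2*m*n≤m*m+n*n : ∀ m n → 2 * m * n ≤ m * m + n * n
2*m*n≤m*m+n*n zero    n       = z≤n
2*m*n≤m*m+n*n (suc m) zero    = ≤-trans (≤-reflexive (*-zeroʳ (2 * suc m))) z≤n
2*m*n≤m*m+n*n (suc m) (suc n) =
  subst₂ _≤_ (lhs m n) (rhs m n) (+-monoˡ-≤ (2 * (m + n + 1)) (2*m*n≤m*m+n*n m n))
  where
  lhs : ∀ m n → 2 * m * n + 2 * (m + n + 1) ≡ 2 * (1 + m) * (1 + n)
  lhs = solve-∀
  rhs : ∀ m n → m * m + n * n + 2 * (m + n + 1) ≡ (1 + m) * (1 + m) + (1 + n) * (1 + n)
  rhs = solve-∀

m≤m*m : ∀ m → m ≤ m * m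
m≤m*m zero    = z≤n
m≤m*m (suc m) = m≤m*n (suc m) (suc m)

module _ {A : Set} where

  sum-map-mono-≤ : ∀ {f g : A → ℕ} → (∀ x → f x ≤ g x) → ∀ xs → sum (map f xs) ≤ sum (map g xs)
  sum-map-mono-≤ f≤g []       = z≤n
  sum-map-mono-≤ f≤g (x ∷ xs) = +-mono-≤ (f≤g x) (sum-map-mono-≤ f≤g xs)

  sum-map-+ : ∀ (f g : A → ℕ) xs → sum (map (λ x → f x + g x) xs) ≡ sum (map f xs) + sum (map g xs)
  sum-map-+ f g []       = refl
  sum-map-+ f g (x ∷ xs) =
    trans (cong (f x + g x +_) (sum-map-+ f g xs)) (interchange (f x) (g x) _ _)

  sum-map-*ˡ : ∀ c (f : A → ℕ) xs → sum (map (λ x → c * f x) xs) ≡ c * sum (map f xs)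
  sum-map-*ˡ c f []       = sym (*-zeroʳ c)
  sum-map-*ˡ c f (x ∷ xs) =
    trans (cong (c * f x +_) (sum-map-*ˡ c f xs)) (sym (*-distribˡ-+ c (f x) _))

  sum-map-snoc : ∀ (f : A → ℕ) xs y → sum (map f (xs ++ [ y ])) ≡ sum (map f xs) + f y
  sum-map-snoc f xs y = begin
    sum (map f (xs ++ [ y ]))        ≡⟨ cong sum (map-++ f xs [ y ]) ⟩
    sum (map f xs ++ [ f y ])        ≡⟨ sum-++ (map f xs) [ f y ] ⟩
    sum (map f xs) + (f y + 0)       ≡⟨ cong (sum (map f xs) +_) (+-identityʳ (f y)) ⟩
    sum (map f xs) + f y             ∎
    where open ≡-Reasoning

  All-concatMap⁺ : ∀ {B : Set} {P : B → Set} {F : A → List B} →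
                   (∀ x → All P (F x)) → ∀ xs → All P (concatMap F xs)
  All-concatMap⁺ allF xs = concat⁺ (All-map⁺ (All.universal allF xs))

  inner : List A → (A → ℕ) → (A → ℕ) → ℕ
  inner xs f g = sum (map (λ x → f x * g x) xs)

  inner-ff≡0⇒inner-fg≡0 : ∀ xs (f g : A → ℕ) → inner xs f f ≡ 0 → inner xs f g ≡ 0
  inner-ff≡0⇒inner-fg≡0 []       f g _    = refl
  inner-ff≡0⇒inner-fg≡0 (x ∷ xs) f g ff≡0
    with f x | m+n≡0⇒m≡0 (f x * f x) ff≡0 | inner-ff≡0⇒inner-fg≡0 xs f g (m+n≡0⇒n≡0 (f x * f x) ff≡0)
  ... | zero  | _  | fg≡0 = fg≡0
  ... | suc _ | () | _

  inner-am-gm : ∀ xs (f g : A → ℕ) a c → 2 * (a * c) * inner xs f g ≤ a * a * inner xs g g + c * c * inner xs f f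
  inner-am-gm xs f g a c = begin
    2 * (a * c) * inner xs f g
      ≡⟨ sum-map-*ˡ (2 * (a * c)) (λ x → f x * g x) xs ⟨
    sum (map (λ x → 2 * (a * c) * (f x * g x)) xs)
      ≤⟨ sum-map-mono-≤ termwise xs ⟩
    sum (map (λ x → a * a * (g x * g x) + c * c * (f x * f x)) xs)
      ≡⟨ sum-map-+ (λ x → a * a * (g x * g x)) (λ x → c * c * (f x * f x)) xs ⟩
    sum (map (λ x → a * a * (g x * g x)) xs) + sum (map (λ x → c * c * (f x * f x)) xs)
      ≡⟨ cong₂ _+_ (sum-map-*ˡ (a * a) (λ x → g x * g x) xs) (sum-map-*ˡ (c * c) (λ x → f x * f x) xs) ⟩
    a * a * inner xs g g + c * c * inner xs f f ∎
    where
    open ≤-Reasoning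
    rearrangeˡ : ∀ a c u v → 2 * (a * v) * (c * u) ≡ 2 * (a * c) * (u * v)
    rearrangeˡ = solve-∀
    rearrangeʳ : ∀ a c u v → a * v * (a * v) + c * u * (c * u) ≡ a * a * (v * v) + c * c * (u * u)
    rearrangeʳ = solve-∀
    termwise : ∀ x → 2 * (a * c) * (f x * g x) ≤ a * a * (g x * g x) + c * c * (f x * f x)
    termwise x = subst₂ _≤_ (rearrangeˡ a c (f x) (g x)) (rearrangeʳ a c (f x) (g x))
                            (2*m*n≤m*m+n*n (a * g x) (c * f x))

  cauchy-schwarz : ∀ xs (f g : A → ℕ) → inner xs f g * inner xs f g ≤ inner xs f f * inner xs g g
  cauchy-schwarz xs f g with inner xs f f in ff≡
  ... | zero  rewrite inner-ff≡0⇒inner-fg≡0 xs f g ff≡ = z≤n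
  ... | suc a = *-cancelˡ-≤ ff (+-cancelʳ-≤ (ff * (fg * fg)) (ff * (fg * fg)) (ff * (ff * gg)) (begin
    ff * (fg * fg) + ff * (fg * fg)    ≡⟨ double ff fg ⟩
    2 * (ff * fg) * fg                 ≤⟨ inner-am-gm xs f g ff fg ⟩
    ff * ff * gg + fg * fg * inner xs f f ≡⟨ cong (λ z → ff * ff * gg + fg * fg * z) ff≡ ⟩
    ff * ff * gg + fg * fg * ff        ≡⟨ regroup ff gg fg ⟩
    ff * (ff * gg) + ff * (fg * fg)    ∎))
    where
    open ≤-Reasoning
    ff gg fg : ℕ
    ff = suc a
    gg = inner xs g g
    fg = inner xs f g
    double : ∀ a c → a * (c * c) + a * (c * c) ≡ 2 * (a * c) * c
    double = solve-∀
    regroup : ∀ a b c → a * a * b + c * c * a ≡ a * (a * b) + a * (c * c)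
    regroup = solve-∀

leqThreePlusTwoSqrt2Times-from-bounds : ∀ {G O P} → G ≤ O + 2 * P → P * P ≤ O * G → LeqThreePlusTwoSqrt2Times G O
leqThreePlusTwoSqrt2Times-from-bounds {G} {O} {P} G≤O+2P P²≤OG with G ≤? 3 * O
... | yes G≤3O = small G≤3O
... | no  G≰3O = large (+-cancelˡ-≤ (4 * (O * O) + 4 * (O * d)) (d * d) (8 * (O * O)) squares)
  where
  d : ℕ
  d = G ∸ 3 * O
  G≡3O+d : G ≡ 3 * O + d
  G≡3O+d = sym (m+[n∸m]≡n (<⇒≤ (≰⇒> G≰3O)))
  3O≡O+2O : ∀ o d → 3 * o + d ≡ o + (2 * o + d)
  3O≡O+2O = solve-∀
  2O+d≤2P : 2 * O + d ≤ 2 * P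
  2O+d≤2P = +-cancelˡ-≤ O (2 * O + d) (2 * P) (subst (_≤ O + 2 * P) (trans G≡3O+d (3O≡O+2O O d)) G≤O+2P)
  squares : 4 * (O * O) + 4 * (O * d) + d * d ≤ 4 * (O * O) + 4 * (O * d) + 8 * (O * O)
  squares = begin
    4 * (O * O) + 4 * (O * d) + d * d          ≡⟨ expandˡ O d ⟩
    (2 * O + d) * (2 * O + d)                  ≤⟨ *-mono-≤ 2O+d≤2P 2O+d≤2P ⟩
    2 * P * (2 * P)                            ≡⟨ double P ⟩
    4 * (P * P)                                ≤⟨ *-monoʳ-≤ 4 P²≤OG ⟩
    4 * (O * G)                                ≡⟨ cong (λ g → 4 * (O * g)) G≡3O+d ⟩
    4 * (O * (3 * O + d))                      ≡⟨ expandʳ O d ⟩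
    4 * (O * O) + 4 * (O * d) + 8 * (O * O)    ∎
    where
    open ≤-Reasoning
    expandˡ : ∀ o d → 4 * (o * o) + 4 * (o * d) + d * d ≡ (2 * o + d) * (2 * o + d)
    expandˡ = solve-∀
    double : ∀ p → 2 * p * (2 * p) ≡ 4 * (p * p)
    double = solve-∀
    expandʳ : ∀ o d → 4 * (o * (3 * o + d)) ≡ 4 * (o * o) + 4 * (o * d) + 8 * (o * o)
    expandʳ = solve-∀

module Fibres {B : Set} (_≟_ : DecidableEquality B) where

  δ : B → B → ℕ
  δ x y = if does (x ≟ y) then 1 else 0

  fibreSize : ∀ {A : Set} → (A → B) → List A → B → ℕ
  fibreSize f xs y = length (filter (λ x → f x ≟ y) xs)

  count : B → List B → ℕ
  count y ys = fibreSize id ys y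

  δ-sym : ∀ x y → δ x y ≡ δ y x
  δ-sym x y with x ≟ y | y ≟ x
  ... | yes _   | yes _   = refl
  ... | no  _   | no  _   = refl
  ... | yes x≡y | no  y≢x = contradiction (sym x≡y) y≢x
  ... | no  x≢y | yes y≡x = contradiction (sym y≡x) x≢y

  δ-*-sift : ∀ x y (h : B → ℕ) → δ x y * h y ≡ δ x y * h x
  δ-*-sift x y h with x ≟ y
  ... | yes refl = refl
  ... | no  _    = refl

  +δ-square : ∀ a x y → (a + δ x y) * (a + δ x y) ≡ a * a + δ x y * (2 * a + 1)
  +δ-square a x y with x ≟ y
  ... | yes _ = [m+n]²≡m²+n[2m+n] a 1
  ... | no  _ = [m+n]²≡m²+n[2m+n] a 0

  fibreSize-∷ : ∀ {A : Set} (f : A → B) x xs y → fibreSize f (x ∷ xs) y ≡ δ (f x) y + fibreSize f xs y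
  fibreSize-∷ f x xs y with f x ≟ y
  ... | yes _ = refl
  ... | no  _ = refl

  fibreSize-++ : ∀ {A : Set} (f : A → B) xs ys y →
                 fibreSize f (xs ++ ys) y ≡ fibreSize f xs y + fibreSize f ys y
  fibreSize-++ f xs ys y =
    trans (cong length (filter-++ (λ x → f x ≟ y) xs ys)) (length-++ (filter (λ x → f x ≟ y) xs))

  fibreSize-++-≤ˡ : ∀ {A : Set} (f : A → B) xs ys y → fibreSize f xs y ≤ fibreSize f (xs ++ ys) y
  fibreSize-++-≤ˡ f xs ys y = ≤-trans (m≤m+n _ _) (≤-reflexive (sym (fibreSize-++ f xs ys y)))

  count-concatMap-mono-≤ : ∀ {A : Set} {F H : A → List B} {y} → (∀ x → count y (F x) ≤ count y (H x)) →
                           ∀ xs → count y (concatMap F xs) ≤ count y (concatMap H xs)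
  count-concatMap-mono-≤ F≤H []                   = z≤n
  count-concatMap-mono-≤ {F = F} {H} {y} F≤H (x ∷ xs) =
    subst₂ _≤_ (sym (fibreSize-++ id (F x) (concatMap F xs) y)) (sym (fibreSize-++ id (H x) (concatMap H xs) y))
      (+-mono-≤ (F≤H x) (count-concatMap-mono-≤ F≤H xs))

  ∈⇒1≤count : ∀ {y ys} → y ∈ ys → 1 ≤ count y ys
  ∈⇒1≤count {y} y∈ys = filter-some (_≟ y) (Any.map sym y∈ys)

  Unique⇒count≤1 : ∀ {y ys} → Unique ys → count y ys ≤ 1
  Unique⇒count≤1 []                        = z≤n
  Unique⇒count≤1 {y} {x ∷ xs} (x∉xs ∷ xs!) with x ≟ y
  ... | yes refl = s≤s (≤-reflexive (cong length (filter-none (_≟ x) (All.map (λ x≢z z≡x → x≢z (sym z≡x)) x∉xs))))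
  ... | no  _    = Unique⇒count≤1 xs!

  sum-δ-* : ∀ x (h : B → ℕ) ys → sum (map (λ y → δ x y * h y) ys) ≡ count x ys * h x
  sum-δ-* x h []       = refl
  sum-δ-* x h (y ∷ ys) = begin
    δ x y * h y + sum (map (λ y → δ x y * h y) ys)
      ≡⟨ cong₂ _+_ (trans (δ-*-sift x y h) (cong (_* h x) (δ-sym x y))) (sum-δ-* x h ys) ⟩
    δ y x * h x + count x ys * h x
      ≡⟨ sym (*-distribʳ-+ (h x) (δ y x) (count x ys)) ⟩
    (δ y x + count x ys) * h x
      ≡⟨ cong (_* h x) (sym (fibreSize-∷ id y ys x)) ⟩
    count x (y ∷ ys) * h x ∎
    where open ≡-Reasoning

  sum-fibreSize-* : ∀ {A : Set} (f : A → B) (h : B → ℕ) ys xs → All (λ x → count (f x) ys ≡ 1) xs →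
                    sum (map (λ y → fibreSize f xs y * h y) ys) ≡ sum (map (h ∘ f) xs)
  sum-fibreSize-* f h ys []       []            = sum-map-*ˡ 0 h ys
  sum-fibreSize-* f h ys (x ∷ xs) (once ∷ rest) = begin
    sum (map (λ y → fibreSize f (x ∷ xs) y * h y) ys)
      ≡⟨ cong sum (map-cong (λ y → trans (cong (_* h y) (fibreSize-∷ f x xs y)) (*-distribʳ-+ (h y) (δ (f x) y) (fibreSize f xs y))) ys) ⟩
    sum (map (λ y → δ (f x) y * h y + fibreSize f xs y * h y) ys)
      ≡⟨ sum-map-+ _ _ ys ⟩
    sum (map (λ y → δ (f x) y * h y) ys) + sum (map (λ y → fibreSize f xs y * h y) ys)
      ≡⟨ cong₂ _+_ (sum-δ-* (f x) h ys) (sum-fibreSize-* f h ys xs rest) ⟩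
    count (f x) ys * h (f x) + sum (map (h ∘ f) xs)
      ≡⟨ cong (λ c → c * h (f x) + sum (map (h ∘ f) xs)) once ⟩
    1 * h (f x) + sum (map (h ∘ f) xs)
      ≡⟨ cong (_+ sum (map (h ∘ f) xs)) (*-identityˡ (h (f x))) ⟩
    sum (map (h ∘ f) (x ∷ xs)) ∎
    where open ≡-Reasoning

lt-trans : ∀ {n} {i j k : Fin n} → lt i j ≡ true → lt j k ≡ true → lt i k ≡ true
lt-trans {i = i} {j} {k} i<j j<k = dec-true (i <?ᶠ k) (<ᶠ-trans (witness (i <?ᶠ j) i<j) (witness (j <?ᶠ k) j<k))
  where
  witness : ∀ {P : Set} (P? : Dec P) → does P? ≡ true → P
  witness (yes p) _  = p
  witness (no _)  ()

concatMap-pairs≡cartesianProduct : ∀ {A B : Set} (xs : List A) (ys : List B) →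
  concatMap (λ x → concatMap (λ y → [ (x , y) ]) ys) xs ≡ cartesianProduct xs ys
concatMap-pairs≡cartesianProduct []       ys = refl
concatMap-pairs≡cartesianProduct (x ∷ xs) ys =
  cong₂ _++_ (trans (sym (concatMap-map [_] (x ,_) ys)) (concatMap-pure (map (x ,_) ys)))
             (concatMap-pairs≡cartesianProduct xs ys)

module _ {n : ℕ} where
  open Fibres (_≟E_ {n})

  -- `edges G` and `triangles G` are built with a conditional that is local to their
  -- definitions; these Σ-types name the per-pair (per-triple) lists, so that they can
  -- be analysed by case on the condition.
  edges-by-pairs : (G : Graph n) →
    Σ[ at ∈ (Fin n → Fin n → List (Edge n)) ] edges G ≡ concatMap (λ i → concatMap (at i) (allFin n)) (allFin n)
  edges-by-pairs G = _ , refl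

  triangles-by-triples : (G : Graph n) →
    Σ[ at ∈ (Fin n → Fin n → Fin n → List (Tri n)) ]
      triangles G ≡ concatMap (λ i → concatMap (λ j → concatMap (at i j) (allFin n)) (allFin n)) (allFin n)
  triangles-by-triples G = _ , refl

  edgesAt : Graph n → Fin n → Fin n → List (Edge n)
  edgesAt G = proj₁ (edges-by-pairs G)

  trianglesAt : Graph n → Fin n → Fin n → Fin n → List (Tri n)
  trianglesAt G = proj₁ (triangles-by-triples G)

  count-edgesAt-≤ : ∀ G i j e → count e (edgesAt G i j) ≤ count e [ (i , j) ]
  count-edgesAt-≤ G i j e with lt i j ∧ adj G i j
  ... | true  = ≤-refl
  ... | false = z≤n

  count-edges-≤1 : ∀ G e → count e (edges G) ≤ 1
  count-edges-≤1 G e = begin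
    count e (edges G)
      ≤⟨ count-concatMap-mono-≤ (λ i → count-concatMap-mono-≤ (λ j → count-edgesAt-≤ G i j e) (allFin n)) (allFin n) ⟩
    count e (concatMap (λ i → concatMap (λ j → [ (i , j) ]) (allFin n)) (allFin n))
      ≡⟨ cong (count e) (concatMap-pairs≡cartesianProduct (allFin n) (allFin n)) ⟩
    count e (cartesianProduct (allFin n) (allFin n))
      ≤⟨ Unique⇒count≤1 (cartesianProduct⁺ (allFin⁺ n) (allFin⁺ n)) ⟩
    1 ∎
    where open ≤-Reasoning

  edge∈edges : ∀ G {i j} → lt i j ≡ true → adj G i j ≡ true → (i , j) ∈ edges G
  edge∈edges G {i} {j} i<j i~j =
    ∈-concatMap⁺ _ (lose (∈-allFin i) (∈-concatMap⁺ (edgesAt G i) (lose (∈-allFin j) (i,j∈edgesAt i<j i~j))))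
    where
    i,j∈edgesAt : lt i j ≡ true → adj G i j ≡ true → (i , j) ∈ edgesAt G i j
    i,j∈edgesAt i<j i~j rewrite i<j | i~j = here refl

  trianglesAt-edges∈edges : ∀ G i j k → All (λ t → ∀ c → triEdge t c ∈ edges G) (trianglesAt G i j k)
  trianglesAt-edges∈edges G i j k
    with lt i j in i<j | lt j k in j<k | adj G i j in i~j | adj G i k in i~k | adj G j k in j~k
  ... | false | _     | _     | _     | _     = []
  ... | true  | false | _     | _     | _     = []
  ... | true  | true  | false | _     | _     = []
  ... | true  | true  | true  | false | _     = []
  ... | true  | true  | true  | true  | false = []
  ... | true  | true  | true  | true  | true  = edges∈ ∷ []
    where
    edges∈ : ∀ c → triEdge (i , j , k) c ∈ edges G
    edges∈ zero             = edge∈edges G i<j i~j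
    edges∈ (suc zero)       = edge∈edges G (lt-trans {i = i} {j} {k} i<j j<k) i~k
    edges∈ (suc (suc zero)) = edge∈edges G j<k j~k

  triangle-edges∈edges : ∀ G → All (λ t → ∀ c → triEdge t c ∈ edges G) (triangles G)
  triangle-edges∈edges G =
    All-concatMap⁺ (λ i → All-concatMap⁺ (λ j → All-concatMap⁺ (trianglesAt-edges∈edges G i j) (allFin n)) (allFin n)) (allFin n)

  count-triangle-edge≡1 : ∀ G (σ : Assignment n) → All (λ t → count (triEdge t (σ t)) (edges G) ≡ 1) (triangles G)
  count-triangle-edge≡1 G σ =
    All.map (λ edges∈ → ≤-antisym (count-edges-≤1 G _) (∈⇒1≤count (edges∈ (σ _)))) (triangle-edges∈edges G)

  decisionEdge : Tri n × Fin 3 → Edge n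
  decisionEdge (t , c) = triEdge t c

  loadL-snoc : ∀ ps t c e → loadL (ps ++ [ (t , c) ]) e ≡ loadL ps e + δ (triEdge t c) e
  loadL-snoc ps t c e = begin
    loadL (ps ++ [ (t , c) ]) e                             ≡⟨ fibreSize-++ decisionEdge ps [ (t , c) ] e ⟩
    loadL ps e + fibreSize decisionEdge [ (t , c) ] e       ≡⟨ cong (loadL ps e +_) (fibreSize-∷ decisionEdge (t , c) [] e) ⟩
    loadL ps e + (δ (triEdge t c) e + 0)                    ≡⟨ cong (loadL ps e +_) (+-identityʳ _) ⟩
    loadL ps e + δ (triEdge t c) e                          ∎
    where open ≡-Reasoning

  module GreedyPotential (E : List (Edge n)) (E-simple : ∀ e → count e E ≤ 1) where

    Φ : List (Tri n × Fin 3) → ℕ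
    Φ ps = sum (map (λ e → loadL ps e * loadL ps e) E)

    Φ-snoc : ∀ ps t c → Φ (ps ++ [ (t , c) ]) ≤ Φ ps + (2 * loadL ps (triEdge t c) + 1)
    Φ-snoc ps t c = begin
      Φ (ps ++ [ (t , c) ])
        ≡⟨ cong sum (map-cong (λ e → trans (cong (λ l → l * l) (loadL-snoc ps t c e)) (+δ-square (L e) x e)) E) ⟩
      sum (map (λ e → L e * L e + δ x e * (2 * L e + 1)) E)
        ≡⟨ sum-map-+ (λ e → L e * L e) (λ e → δ x e * (2 * L e + 1)) E ⟩
      Φ ps + sum (map (λ e → δ x e * (2 * L e + 1)) E)
        ≡⟨ cong (Φ ps +_) (sum-δ-* x (λ e → 2 * L e + 1) E) ⟩
      Φ ps + count x E * (2 * L x + 1)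
        ≤⟨ +-monoʳ-≤ (Φ ps) (*-monoˡ-≤ (2 * L x + 1) (E-simple x)) ⟩
      Φ ps + 1 * (2 * L x + 1)
        ≡⟨ cong (Φ ps +_) (*-identityˡ _) ⟩
      Φ ps + (2 * L x + 1) ∎
      where
      open ≤-Reasoning
      x : Edge n
      x = triEdge t c
      L : Edge n → ℕ
      L = loadL ps

    σ-cost : Assignment n → List (Tri n × Fin 3) → Tri n × Fin 3 → ℕ
    σ-cost σ ps (t , _) = 2 * loadL ps (triEdge t (σ t)) + 1

    σ-cost-mono : ∀ σ ps qs p → σ-cost σ ps p ≤ σ-cost σ (ps ++ qs) p
    σ-cost-mono σ ps qs (t , _) = +-monoˡ-≤ 1 (*-monoʳ-≤ 2 (fibreSize-++-≤ˡ decisionEdge ps qs (triEdge t (σ t))))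

    Φ-greedy : ∀ {ps} → GreedyRun ps → ∀ σ → Φ ps ≤ sum (map (σ-cost σ ps) ps)
    Φ-greedy done σ = ≤-reflexive (sum-map-*ˡ 0 (λ _ → 0) E)
    Φ-greedy (step {ps} run t c minimal) σ = begin
      Φ ps′
        ≤⟨ Φ-snoc ps t c ⟩
      Φ ps + (2 * loadL ps (triEdge t c) + 1)
        ≤⟨ +-mono-≤ (Φ-greedy run σ) (+-monoˡ-≤ 1 (*-monoʳ-≤ 2 (minimal (σ t)))) ⟩
      sum (map (σ-cost σ ps) ps) + σ-cost σ ps (t , c)
        ≤⟨ +-mono-≤ (sum-map-mono-≤ (σ-cost-mono σ ps [ (t , c) ]) ps) (σ-cost-mono σ ps [ (t , c) ] (t , c)) ⟩
      sum (map (σ-cost σ ps′) ps) + σ-cost σ ps′ (t , c)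
        ≡⟨ sum-map-snoc (σ-cost σ ps′) ps (t , c) ⟨
      sum (map (σ-cost σ ps′) ps′) ∎
      where
      open ≤-Reasoning
      ps′ : List (Tri n × Fin 3)
      ps′ = ps ++ [ (t , c) ]

  greedyObjective≤objective+2*inner : ∀ (G : Graph n) (g : Greedy G) σ →
    greedyObjective g ≤ objective G σ + 2 * inner (edges G) (loadA G σ) (loadL (decisions g))
  greedyObjective≤objective+2*inner G g σ = begin
    greedyObjective g
      ≤⟨ Φ-greedy (isRun g) σ ⟩
    sum (map (σ-cost σ ps) ps)
      ≡⟨ cong sum (map-∘ ps) ⟩
    sum (map cost (map proj₁ ps))
      ≡⟨ sum-↭ (map⁺ cost (covers g)) ⟩
    sum (map cost (triangles G))
      ≡⟨ sum-fibreSize-* opt (λ e → 2 * ℓ e + 1) E (triangles G) (count-triangle-edge≡1 G σ) ⟨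
    sum (map (λ e → o e * (2 * ℓ e + 1)) E)
      ≡⟨ cong sum (map-cong (λ e → distrib (o e) (ℓ e)) E) ⟩
    sum (map (λ e → 2 * (o e * ℓ e) + o e) E)
      ≡⟨ sum-map-+ (λ e → 2 * (o e * ℓ e)) o E ⟩
    sum (map (λ e → 2 * (o e * ℓ e)) E) + sum (map o E)
      ≤⟨ +-mono-≤ (≤-reflexive (sum-map-*ˡ 2 (λ e → o e * ℓ e) E)) (sum-map-mono-≤ (λ e → m≤m*m (o e)) E) ⟩
    2 * inner E o ℓ + objective G σ
      ≡⟨ +-comm (2 * inner E o ℓ) (objective G σ) ⟩
    objective G σ + 2 * inner E o ℓ ∎
    where
    open ≤-Reasoning
    open GreedyPotential (edges G) (count-edges-≤1 G)
    E : List (Edge n)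
    E = edges G
    ps : List (Tri n × Fin 3)
    ps = decisions g
    opt : Tri n → Edge n
    opt t = triEdge t (σ t)
    o ℓ : Edge n → ℕ
    o = loadA G σ
    ℓ = loadL ps
    cost : Tri n → ℕ
    cost t = 2 * ℓ (opt t) + 1
    distrib : ∀ a b → a * (2 * b + 1) ≡ 2 * (a * b) + a
    distrib = solve-∀

mainTheorem2 : ∀ {n : ℕ} (G : Graph n) (g : Greedy G) (σ : Assignment n) →
    LeqThreePlusTwoSqrt2Times (greedyObjective g) (objective G σ)
mainTheorem2 {n} G g σ =
  leqThreePlusTwoSqrt2Times-from-bounds {P = inner (edges G) o ℓ}
    (greedyObjective≤objective+2*inner G g σ)
    (cauchy-schwarz (edges G) o ℓ)
  where
  o ℓ : Edge n → ℕ
  o = loadA G σ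
  ℓ = loadL (decisions g)
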